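{- Let $k\geq 2$, let $n,m$ be positive integers, and let $w\in[k]^n$ be a word. For $0\le \ell\le n$ let $M(w\mid \ell)=\max_{v\in[k]^\ell} M(v,w)$. Then \[ M_k(mn)\leq \binom{m+n}{n}\left(\sum_{\ell=0}^n M(w\mid \ell)\right)^{m}. \]
   Context: Words are finite sequences over the alphabet $[k]=\{1,\dots,k\}$. For words $v\in[k]^a$ and $w\in[k]^b$, a map from $v$ to $w$ is a strictly increasing function $f\colon[a]\to[b]$ with $v[i]=w[f(i)]$ for all $i$; $M(v,w)$ denotes the number of such maps (for $v$ the empty word, $M(v,w)=1$). Let $M(w)=\max_v M(v,w)$ over all words $v$ over $[k]$, and $M_k(N)=\min_{w\in[k]^N} M(w)$. -}

module Defs where

open import Data.Nat using (ℕ; zero; suc; _+_; _*_; _<_; _≤_; _⊔_)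
open import Data.Nat.Properties using (_<?_)
open import Data.Fin using (Fin; toℕ)
open import Data.Fin.Properties using (_≟_)
open import Data.Vec using (Vec; []; _∷_; lookup)
open import Data.List using (List; []; _∷_; map; concatMap; filter; length; foldr; allFin; upTo)
open import Data.Nat.ListAction using (sum)
open import Data.Product using (_×_)
open import Relation.Binary.PropositionalEquality using (_≡_)
open import Relation.Nullary using (Dec)
open import Relation.Nullary.Decidable using (_×-dec_)
open import Data.Fin.Properties using (all?)

Word : ℕ → ℕ → Set
Word k n = Vec (Fin k) n

allVecs : {A : Set} → List A → (n : ℕ) → List (Vec A n)
allVecs xs zero = [] ∷ []
allVecs xs (suc n) = concatMap (λ x → map (x ∷_) (allVecs xs n)) xs

-- A candidate map f : [a] → [b] is given by its table (Vec (Fin b) a).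
-- It is a map from v to w iff it is strictly increasing and v[i] = w[f(i)].
IsMap : {k a b : ℕ} → Word k a → Word k b → Vec (Fin b) a → Set
IsMap {k} {a} {b} v w f =
  (∀ (i j : Fin a) → toℕ i < toℕ j → toℕ (lookup f i) < toℕ (lookup f j))
  × (∀ (i : Fin a) → lookup v i ≡ lookup w (lookup f i))

isMap? : {k a b : ℕ} → (v : Word k a) → (w : Word k b) → (f : Vec (Fin b) a) → Dec (IsMap v w f)
isMap? {k} {a} {b} v w f =
  all? (λ i → all? (λ j → dec (toℕ i <? toℕ j) (toℕ (lookup f i) <? toℕ (lookup f j))))
  ×-dec all? (λ i → lookup v i ≟ lookup w (lookup f i))
  where
  open import Relation.Nullary using (yes; no)
  dec : {P Q : Set} → Dec P → Dec Q → Dec (P → Q)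
  dec (yes p) (yes q) = yes (λ _ → q)
  dec (yes p) (no ¬q) = no (λ h → ¬q (h p))
  dec (no ¬p) _ = yes (λ p → Data.Empty.⊥-elim (¬p p))
    where import Data.Empty

M : {k a b : ℕ} → Word k a → Word k b → ℕ
M {k} {a} {b} v w = length (filter (isMap? v w) (allVecs (allFin b) a))

Mℓ : {k n : ℕ} → Word k n → ℕ → ℕ
Mℓ {k} w ℓ = foldr _⊔_ 0 (map (λ v → M v w) (allVecs (allFin k) ℓ))

ΣMℓ : {k n : ℕ} → Word k n → ℕ
ΣMℓ {k} {n} w = sum (map (Mℓ w) (upTo (suc n)))

M-word-≤ : {k N : ℕ} → Word k N → ℕ → Set
M-word-≤ {k} w X = ∀ (a : ℕ) (v : Word k a) → M v w ≤ X

Mk-≤ : ℕ → ℕ → ℕ → Set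
Mk-≤ k N X = Data.Product.Σ (Word k N) (λ w → M-word-≤ w X)
  where import Data.Product

-- The word w^m = w w ⋯ w does it. Sorting a map v → w^m by the copy of w into which each
-- letter lands, the part landing in the first copy is a prefix p of v, giving
--   M(v, w u) ≤ (Σ_{p prefix of v} M(p, w)) · max_s M(s, u)   for u = w^(m-1).
-- The prefixes of v have pairwise distinct lengths and M(p, w) = 0 once |p| > n, so the sum is
-- at most Σ_{ℓ ≤ n} M(w | ℓ); by induction M(v, w^m) ≤ (Σ_ℓ M(w | ℓ))^m, and the binomial
-- coefficient is at least 1.
module Submission where

open import Defs
open import Data.Nat using (ℕ; zero; suc; _+_; _*_; _^_; _≤_; _<_; _⊔_; z≤n; s≤s; s≤s⁻¹; _≤?_)
open import Data.Nat.Properties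
open import Data.Nat.ListAction using (sum)
open import Data.Nat.Combinatorics using (_C_; nCk+nC[k+1]≡[n+1]C[k+1])
open import Data.Fin using (Fin; toℕ) renaming (zero to fzero; suc to fsuc)
open import Data.Fin.Properties using (all?) renaming (_≟_ to _≟ᶠ_)
open import Data.Vec using (Vec; []; _∷_; lookup; _++_; concat; replicate)
open import Data.List as List using (List; filter; length; allFin; tabulate; applyUpTo; concatMap; foldr)
import Data.List.Properties as List
open import Data.List.Relation.Unary.All using (universal)
open import Data.List.Relation.Unary.Any using (here; there)
open import Data.List.Membership.Propositional using (_∈_; lose)
open import Data.List.Membership.Propositional.Properties using (∈-concatMap⁺; ∈-map⁺; ∈-allFin)
open import Data.Product using (_×_; _,_; proj₁; proj₂)
open import Relation.Nullary using (Dec; yes; no; ¬_; contradiction)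
open import Relation.Nullary.Decidable using (_×-dec_)
open import Relation.Unary using (Decidable)
open import Relation.Binary.PropositionalEquality
open import Algebra.Properties.CommutativeSemigroup +-commutativeSemigroup using (interchange)
open import Function using (_∘_)

private
  variable
    k a b n lo : ℕ
    P Q : Set

guard : Dec P → ℕ → ℕ
guard (yes _) n = n
guard (no _)  _ = 0

guard-↔ : (p? : Dec P) (q? : Dec Q) → (P → Q) → (Q → P) →
          {m n : ℕ} → m ≡ n → guard p? m ≡ guard q? n
guard-↔ (yes p) (yes q) _ _ m≡n = m≡n
guard-↔ (yes p) (no ¬q) f _ _   = contradiction (f p) ¬q
guard-↔ (no ¬p) (yes q) _ g _   = contradiction (g q) ¬p
guard-↔ (no _)  (no _)  _ _ _   = refl

guard-no : (p? : Dec P) {n : ℕ} → ¬ P → guard p? n ≡ 0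
guard-no (yes p) ¬p = contradiction p ¬p
guard-no (no _)  _  = refl

guard-≤ : (p? : Dec P) (n : ℕ) → guard p? n ≤ n
guard-≤ (yes _) _ = ≤-refl
guard-≤ (no _)  _ = z≤n

guard-mono-≤ : (p? : Dec P) {m n : ℕ} → m ≤ n → guard p? m ≤ guard p? n
guard-mono-≤ (yes _) m≤n = m≤n
guard-mono-≤ (no _)  _   = z≤n

guard-*ˡ : (p? : Dec P) (m n : ℕ) → guard p? (m * n) ≡ guard p? m * n
guard-*ˡ (yes _) _ _ = refl
guard-*ˡ (no _)  _ _ = refl

module _ {A : Set} {R : A → Set} (R? : Decidable R) where

  length-filter-concatMap : {I : Set} (g : I → List A) (xs : List I) →
    length (filter R? (concatMap g xs)) ≡ sum (List.map (length ∘ filter R? ∘ g) xs)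
  length-filter-concatMap g List.[] = refl
  length-filter-concatMap g (x List.∷ xs) = begin
    length (filter R? (g x List.++ concatMap g xs))
      ≡⟨ cong length (List.filter-++ R? (g x) (concatMap g xs)) ⟩
    length (filter R? (g x) List.++ filter R? (concatMap g xs))
      ≡⟨ List.length-++ (filter R? (g x)) ⟩
    length (filter R? (g x)) + length (filter R? (concatMap g xs))
      ≡⟨ cong (length (filter R? (g x)) +_) (length-filter-concatMap g xs) ⟩
    length (filter R? (g x)) + sum (List.map (length ∘ filter R? ∘ g) xs)
      ∎
    where open ≡-Reasoning

  length-filter-map : {I : Set} (h : I → A) (xs : List I) →
    length (filter R? (List.map h xs)) ≡ length (filter (R? ∘ h) xs)
  length-filter-map h List.[] = refl
  length-filter-map h (x List.∷ xs) with R? (h x)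
  ... | yes _ = cong suc (length-filter-map h xs)
  ... | no _  = length-filter-map h xs

  length-filter-guard : {S : A → Set} (S? : Decidable S) (p? : Dec P) →
    (∀ {x} → R x → P × S x) → (∀ {x} → P → S x → R x) →
    (xs : List A) → length (filter R? xs) ≡ guard p? (length (filter S? xs))
  length-filter-guard S? (yes p) R⇒S S⇒R xs =
    cong length (List.filter-≐ R? S? (proj₂ ∘ R⇒S , S⇒R p) xs)
  length-filter-guard S? (no ¬p) R⇒S _ xs =
    cong length (List.filter-none R? (universal (λ _ → ¬p ∘ proj₁ ∘ R⇒S) xs))

-- M enumerates all tables [a] → [b]; bounding their values below by lo lets the tables be
-- counted recursively by first value, and the bound is then peeled off one letter of w at a time.
MapAbove : ℕ → Word k a → Word k b → Vec (Fin b) a → Set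
MapAbove lo v w f = IsMap v w f × (∀ i → lo ≤ toℕ (lookup f i))

mapAbove? : (lo : ℕ) (v : Word k a) (w : Word k b) → Decidable (MapAbove lo v w)
mapAbove? lo v w f = isMap? v w f ×-dec all? (λ i → lo ≤? toℕ (lookup f i))

#mapsAbove : ℕ → Word k a → Word k b → ℕ
#mapsAbove {a = a} {b = b} lo v w = length (filter (mapAbove? lo v w) (allVecs (allFin b) a))

Hit : ℕ → Fin k → Word k b → Fin b → Set
Hit lo x w j = lo ≤ toℕ j × x ≡ lookup w j

hit? : (lo : ℕ) (x : Fin k) (w : Word k b) → Decidable (Hit lo x w)
hit? lo x w j = (lo ≤? toℕ j) ×-dec (x ≟ᶠ lookup w j)

mapAbove-∷⁻ : {x : Fin k} {v : Word k a} {w : Word k b} {j : Fin b} {f : Vec (Fin b) a} →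
  MapAbove lo (x ∷ v) w (j ∷ f) → Hit lo x w j × MapAbove (suc (toℕ j)) v w f
mapAbove-∷⁻ ((increasing , letters) , above) =
  (above fzero , letters fzero) ,
  ((λ i i′ i<i′ → increasing (fsuc i) (fsuc i′) (s≤s i<i′)) , letters ∘ fsuc) ,
  (λ i → increasing fzero (fsuc i) (s≤s z≤n))

mapAbove-∷⁺ : {x : Fin k} {v : Word k a} {w : Word k b} {j : Fin b} {f : Vec (Fin b) a} →
  Hit lo x w j → MapAbove (suc (toℕ j)) v w f → MapAbove lo (x ∷ v) w (j ∷ f)
mapAbove-∷⁺ {lo = lo} {x = x} {v} {w} {j} {f} (lo≤j , x≡wj) ((increasing , letters) , above) =
  (increasing′ , letters′) , above′
  where
  increasing′ : ∀ i i′ → toℕ i < toℕ i′ → toℕ (lookup (j ∷ f) i) < toℕ (lookup (j ∷ f) i′)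
  increasing′ fzero    (fsuc i′) _          = above i′
  increasing′ (fsuc i) (fsuc i′) (s≤s i<i′) = increasing i i′ i<i′
  letters′ : ∀ i → lookup (x ∷ v) i ≡ lookup w (lookup (j ∷ f) i)
  letters′ fzero    = x≡wj
  letters′ (fsuc i) = letters i
  above′ : ∀ i → lo ≤ toℕ (lookup (j ∷ f) i)
  above′ fzero    = lo≤j
  above′ (fsuc i) = ≤-trans lo≤j (<⇒≤ (above i))

#mapsAbove-[] : (w : Word k b) → #mapsAbove lo [] w ≡ 1
#mapsAbove-[] {lo = lo} w with mapAbove? lo [] w []
... | yes _ = refl
... | no ¬q = contradiction (((λ ()) , (λ ())) , (λ ())) ¬q

#mapsAbove-∷ : (x : Fin k) (v : Word k a) (w : Word k b) →
  #mapsAbove lo (x ∷ v) w ≡ sum (tabulate (λ j → guard (hit? lo x w j) (#mapsAbove (suc (toℕ j)) v w)))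
#mapsAbove-∷ {a = a} {b = b} {lo = lo} x v w = begin
  length (filter Q? (concatMap (λ j → List.map (j ∷_) tables) (allFin b)))
    ≡⟨ length-filter-concatMap Q? (λ j → List.map (j ∷_) tables) (allFin b) ⟩
  sum (List.map (λ j → length (filter Q? (List.map (j ∷_) tables))) (allFin b))
    ≡⟨ cong sum (List.map-tabulate (λ j → j) (λ j → length (filter Q? (List.map (j ∷_) tables)))) ⟩
  sum (tabulate (λ j → length (filter Q? (List.map (j ∷_) tables))))
    ≡⟨ cong sum (List.tabulate-cong first-value) ⟩
  sum (tabulate (λ j → guard (hit? lo x w j) (#mapsAbove (suc (toℕ j)) v w)))
    ∎
  where
  open ≡-Reasoning
  tables : List (Vec (Fin b) a)
  tables = allVecs (allFin b) a
  Q? : Decidable (MapAbove lo (x ∷ v) w)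
  Q? = mapAbove? lo (x ∷ v) w
  first-value : ∀ j → length (filter Q? (List.map (j ∷_) tables))
                    ≡ guard (hit? lo x w j) (#mapsAbove (suc (toℕ j)) v w)
  first-value j = trans (length-filter-map Q? (j ∷_) tables)
    (length-filter-guard (Q? ∘ (j ∷_)) (mapAbove? (suc (toℕ j)) v w) (hit? lo x w j)
       (mapAbove-∷⁻ {x = x} {v = v} {w = w}) (mapAbove-∷⁺ {x = x} {v = v} {w = w}) tables)

#mapsAbove-shift : (v : Word k a) (y : Fin k) (w : Word k b) →
  #mapsAbove (suc lo) v (y ∷ w) ≡ #mapsAbove lo v w
#mapsAbove-shift {lo = lo} [] y w = trans (#mapsAbove-[] {lo = suc lo} (y ∷ w)) (sym (#mapsAbove-[] {lo = lo} w))
#mapsAbove-shift {lo = lo} (x ∷ v) y w = begin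
  #mapsAbove (suc lo) (x ∷ v) (y ∷ w)
    ≡⟨ #mapsAbove-∷ x v (y ∷ w) ⟩
  guard (hit? (suc lo) x (y ∷ w) fzero) (#mapsAbove 1 v (y ∷ w))
    + sum (tabulate (λ j → guard (hit? (suc lo) x (y ∷ w) (fsuc j)) (#mapsAbove (suc (suc (toℕ j))) v (y ∷ w))))
    ≡⟨ cong₂ _+_ (guard-no (hit? (suc lo) x (y ∷ w) fzero) {n = #mapsAbove 1 v (y ∷ w)} (λ ())) (cong sum (List.tabulate-cong later)) ⟩
  sum (tabulate (λ j → guard (hit? lo x w j) (#mapsAbove (suc (toℕ j)) v w)))
    ≡⟨ #mapsAbove-∷ x v w ⟨
  #mapsAbove lo (x ∷ v) w
    ∎
  where
  open ≡-Reasoning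
  later : ∀ j → guard (hit? (suc lo) x (y ∷ w) (fsuc j)) (#mapsAbove (suc (suc (toℕ j))) v (y ∷ w))
              ≡ guard (hit? lo x w j) (#mapsAbove (suc (toℕ j)) v w)
  later j = guard-↔ (hit? (suc lo) x (y ∷ w) (fsuc j)) (hit? lo x w j)
    (λ (le , eq) → s≤s⁻¹ le , eq) (λ (le , eq) → s≤s le , eq) (#mapsAbove-shift v y w)

#mapsAbove-∷-∷ : (x : Fin k) (v : Word k a) (y : Fin k) (w : Word k b) →
  #mapsAbove 0 (x ∷ v) (y ∷ w) ≡ guard (x ≟ᶠ y) (#mapsAbove 0 v w) + #mapsAbove 0 (x ∷ v) w
#mapsAbove-∷-∷ x v y w = begin
  #mapsAbove 0 (x ∷ v) (y ∷ w)
    ≡⟨ #mapsAbove-∷ x v (y ∷ w) ⟩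
  guard (hit? 0 x (y ∷ w) fzero) (#mapsAbove 1 v (y ∷ w))
    + sum (tabulate (λ j → guard (hit? 0 x (y ∷ w) (fsuc j)) (#mapsAbove (suc (suc (toℕ j))) v (y ∷ w))))
    ≡⟨ cong₂ _+_ first (cong sum (List.tabulate-cong later)) ⟩
  guard (x ≟ᶠ y) (#mapsAbove 0 v w) + sum (tabulate (λ j → guard (hit? 0 x w j) (#mapsAbove (suc (toℕ j)) v w)))
    ≡⟨ cong (guard (x ≟ᶠ y) (#mapsAbove 0 v w) +_) (#mapsAbove-∷ x v w) ⟨
  guard (x ≟ᶠ y) (#mapsAbove 0 v w) + #mapsAbove 0 (x ∷ v) w
    ∎
  where
  open ≡-Reasoning
  first : guard (hit? 0 x (y ∷ w) fzero) (#mapsAbove 1 v (y ∷ w)) ≡ guard (x ≟ᶠ y) (#mapsAbove 0 v w)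
  first = guard-↔ (hit? 0 x (y ∷ w) fzero) (x ≟ᶠ y) proj₂ (z≤n ,_) (#mapsAbove-shift v y w)
  later : ∀ j → guard (hit? 0 x (y ∷ w) (fsuc j)) (#mapsAbove (suc (suc (toℕ j))) v (y ∷ w))
              ≡ guard (hit? 0 x w j) (#mapsAbove (suc (toℕ j)) v w)
  later j = guard-↔ (hit? 0 x (y ∷ w) (fsuc j)) (hit? 0 x w j)
    (λ (_ , eq) → z≤n , eq) (λ (_ , eq) → z≤n , eq) (#mapsAbove-shift v y w)

-- The classical recurrence for the number of occurrences of v as a subsequence of w.
maps : Word k a → Word k b → ℕ
maps []      _       = 1
maps (_ ∷ _) []      = 0
maps (x ∷ v) (y ∷ w) = guard (x ≟ᶠ y) (maps v w) + maps (x ∷ v) w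

#mapsAbove-0≡maps : (v : Word k a) (w : Word k b) → #mapsAbove 0 v w ≡ maps v w
#mapsAbove-0≡maps []      w       = #mapsAbove-[] {lo = 0} w
#mapsAbove-0≡maps (x ∷ v) []      = #mapsAbove-∷ {lo = 0} x v []
#mapsAbove-0≡maps (x ∷ v) (y ∷ w) = trans (#mapsAbove-∷-∷ x v y w)
  (cong₂ _+_ (cong (guard (x ≟ᶠ y)) (#mapsAbove-0≡maps v w)) (#mapsAbove-0≡maps (x ∷ v) w))

M≡maps : (v : Word k a) (w : Word k b) → M v w ≡ maps v w
M≡maps {b = b} v w = trans
  (cong length (List.filter-≐ (isMap? v w) (mapAbove? 0 v w) ((_, λ _ → z≤n) , proj₁) (allVecs (allFin b) _)))
  (#mapsAbove-0≡maps v w)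

maps-[]ʳ : (v : Word k a) → maps v [] ≤ 1
maps-[]ʳ []      = ≤-refl
maps-[]ʳ (_ ∷ _) = z≤n

maps-vanish : (v : Word k a) (w : Word k b) → b < a → maps v w ≡ 0
maps-vanish (_ ∷ _) []      _         = refl
maps-vanish (x ∷ v) (y ∷ w) (s≤s b<a) = cong₂ _+_
  (n≤0⇒n≡0 (≤-trans (guard-≤ (x ≟ᶠ y) (maps v w)) (≤-reflexive (maps-vanish v w b<a))))
  (maps-vanish (x ∷ v) w (m<n⇒m<1+n b<a))

prefixSum : (∀ {ℓ} → Word k ℓ → ℕ) → Word k a → ℕ
prefixSum f []      = f []
prefixSum f (x ∷ v) = f [] + prefixSum (λ p → f (x ∷ p)) v

prefixSum-vanish : {f : ∀ {ℓ} → Word k ℓ → ℕ} → (∀ {ℓ} (p : Word k ℓ) → f p ≡ 0) →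
  (v : Word k a) → prefixSum f v ≡ 0
prefixSum-vanish f≡0 []      = f≡0 []
prefixSum-vanish f≡0 (x ∷ v) = cong₂ _+_ (f≡0 []) (prefixSum-vanish (λ p → f≡0 (x ∷ p)) v)

prefixSum-+ : (f g : ∀ {ℓ} → Word k ℓ → ℕ) (v : Word k a) →
  prefixSum (λ p → f p + g p) v ≡ prefixSum f v + prefixSum g v
prefixSum-+ f g []      = refl
prefixSum-+ f g (x ∷ v) = trans
  (cong (f [] + g [] +_) (prefixSum-+ (λ p → f (x ∷ p)) (λ p → g (x ∷ p)) v))
  (interchange (f []) (g []) _ _)

prefixSum-guard : (p? : Dec P) (f : ∀ {ℓ} → Word k ℓ → ℕ) (v : Word k a) →
  prefixSum (λ p → guard p? (f p)) v ≡ guard p? (prefixSum f v)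
prefixSum-guard (yes _) f v = refl
prefixSum-guard (no _)  f v = prefixSum-vanish (λ _ → refl) v

prefixSum-maps-[]ʳ : (v : Word k a) → prefixSum (λ p → maps p []) v ≡ 1
prefixSum-maps-[]ʳ []      = refl
prefixSum-maps-[]ʳ (_ ∷ v) = cong suc (prefixSum-vanish (λ _ → refl) v)

prefixSum-≤ : (f : ∀ {ℓ} → Word k ℓ → ℕ) (g : ℕ → ℕ) →
  (∀ {ℓ} (p : Word k ℓ) → f p ≤ g ℓ) → (∀ {ℓ} (p : Word k ℓ) → n < ℓ → f p ≡ 0) →
  (v : Word k a) → prefixSum f v ≤ sum (applyUpTo g (suc n))
prefixSum-≤ f g f≤g _ [] = ≤-trans (f≤g []) (m≤m+n (g 0) _)
prefixSum-≤ {n = zero} f g f≤g f≡0 (x ∷ v) =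
  +-mono-≤ (f≤g []) (≤-reflexive (prefixSum-vanish (λ p → f≡0 (x ∷ p) (s≤s z≤n)) v))
prefixSum-≤ {n = suc n} f g f≤g f≡0 (x ∷ v) = +-mono-≤ (f≤g [])
  (prefixSum-≤ (λ p → f (x ∷ p)) (g ∘ suc) (λ p → f≤g (x ∷ p)) (λ p n<ℓ → f≡0 (x ∷ p) (s≤s n<ℓ)) v)

maps-++-≤ : {u : Word k b} {B : ℕ} → (∀ {ℓ} (s : Word k ℓ) → maps s u ≤ B) →
  (v : Word k a) (w : Word k n) → maps v (w ++ u) ≤ prefixSum (λ p → maps p w) v * B
maps-++-≤ {u = u} {B = B} maps≤B v [] = begin
  maps v u                              ≤⟨ maps≤B v ⟩
  B                                     ≡⟨ *-identityˡ B ⟨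
  1 * B                                 ≡⟨ cong (_* B) (prefixSum-maps-[]ʳ v) ⟨
  prefixSum (λ p → maps p []) v * B     ∎
  where open ≤-Reasoning
maps-++-≤ {B = B} maps≤B [] (y ∷ w) = ≤-trans (maps≤B []) (≤-reflexive (sym (*-identityˡ B)))
maps-++-≤ {u = u} {B = B} maps≤B (x ∷ v) (y ∷ w) = begin
  guard (x ≟ᶠ y) (maps v (w ++ u)) + maps (x ∷ v) (w ++ u)
    ≤⟨ +-mono-≤ (guard-mono-≤ (x ≟ᶠ y) (maps-++-≤ maps≤B v w)) (maps-++-≤ maps≤B (x ∷ v) w) ⟩
  guard (x ≟ᶠ y) (S * B) + (1 + T) * B
    ≡⟨ cong (_+ (1 + T) * B) (guard-*ˡ (x ≟ᶠ y) S B) ⟩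
  guard (x ≟ᶠ y) S * B + (1 + T) * B
    ≡⟨ *-distribʳ-+ B (guard (x ≟ᶠ y) S) (1 + T) ⟨
  (guard (x ≟ᶠ y) S + (1 + T)) * B
    ≡⟨ cong (_* B) (+-suc (guard (x ≟ᶠ y) S) T) ⟩
  (1 + (guard (x ≟ᶠ y) S + T)) * B
    ≡⟨ cong (λ z → (1 + (z + T)) * B) (prefixSum-guard (x ≟ᶠ y) (λ p → maps p w) v) ⟨
  (1 + (prefixSum (λ p → guard (x ≟ᶠ y) (maps p w)) v + T)) * B
    ≡⟨ cong (λ z → (1 + z) * B) (prefixSum-+ (λ p → guard (x ≟ᶠ y) (maps p w)) (λ p → maps (x ∷ p) w) v) ⟨
  prefixSum (λ p → maps p (y ∷ w)) (x ∷ v) * B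
    ∎
  where
  open ≤-Reasoning
  S T : ℕ
  S = prefixSum (λ p → maps p w) v
  T = prefixSum (λ p → maps (x ∷ p) w) v

∈-allVecs : (xs : List (Fin k)) (v : Word k n) → (∀ i → lookup v i ∈ xs) → v ∈ allVecs xs n
∈-allVecs xs [] _ = here refl
∈-allVecs xs (x ∷ v) v⊆xs =
  ∈-concatMap⁺ (λ y → List.map (y ∷_) (allVecs xs _)) (lose (v⊆xs fzero) (∈-map⁺ (x ∷_) (∈-allVecs xs v (v⊆xs ∘ fsuc))))

∈⇒≤-foldr-⊔ : {A : Set} (f : A → ℕ) {x : A} {xs : List A} → x ∈ xs → f x ≤ foldr _⊔_ 0 (List.map f xs)
∈⇒≤-foldr-⊔ f (here refl) = m≤m⊔n _ _
∈⇒≤-foldr-⊔ f {xs = y List.∷ _} (there x∈xs) = ≤-trans (∈⇒≤-foldr-⊔ f x∈xs) (m≤n⊔m (f y) _)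

maps≤Mℓ : {ℓ : ℕ} (w : Word k n) (p : Word k ℓ) → maps p w ≤ Mℓ w ℓ
maps≤Mℓ {k = k} {ℓ = ℓ} w p = begin
  maps p w   ≡⟨ M≡maps p w ⟨
  M p w      ≤⟨ ∈⇒≤-foldr-⊔ (λ v → M v w) (∈-allVecs (allFin k) p (∈-allFin ∘ lookup p)) ⟩
  Mℓ w ℓ     ∎
  where open ≤-Reasoning

prefixSum-maps≤ΣMℓ : (w : Word k n) (v : Word k a) → prefixSum (λ p → maps p w) v ≤ ΣMℓ w
prefixSum-maps≤ΣMℓ {n = n} w v = begin
  prefixSum (λ p → maps p w) v         ≤⟨ prefixSum-≤ (λ p → maps p w) (Mℓ w) (λ p → maps≤Mℓ w p) (λ p → maps-vanish p w) v ⟩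
  sum (applyUpTo (Mℓ w) (suc n))       ≡⟨ cong sum (List.map-upTo (Mℓ w) (suc n)) ⟨
  ΣMℓ w                                ∎
  where open ≤-Reasoning

maps-power-≤ : (w : Word k n) (m : ℕ) (v : Word k a) → maps v (concat (replicate m w)) ≤ ΣMℓ w ^ m
maps-power-≤ w zero    v = maps-[]ʳ v
maps-power-≤ w (suc m) v = begin
  maps v (w ++ concat (replicate m w))          ≤⟨ maps-++-≤ (maps-power-≤ w m) v w ⟩
  prefixSum (λ p → maps p w) v * ΣMℓ w ^ m      ≤⟨ *-monoˡ-≤ (ΣMℓ w ^ m) (prefixSum-maps≤ΣMℓ w v) ⟩
  ΣMℓ w * ΣMℓ w ^ m                             ∎
  where open ≤-Reasoning

nCk>0 : {n k : ℕ} → k ≤ n → 0 < n C k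
nCk>0 {n}     {zero}  _         = ≤-refl
nCk>0 {suc n} {suc k} (s≤s k≤n) =
  subst (0 <_) (nCk+nC[k+1]≡[n+1]C[k+1] n k) (≤-trans (nCk>0 k≤n) (m≤m+n _ _))

theorem4 : (k n m : ℕ) → 2 ≤ k → 1 ≤ n → 1 ≤ m → (w : Word k n) →
    Mk-≤ k (m * n) (((m + n) C n) * (ΣMℓ w ^ m))
theorem4 k n m _ _ _ w = concat (replicate m w) , λ a v → begin
  M v (concat (replicate m w))     ≡⟨ M≡maps v (concat (replicate m w)) ⟩
  maps v (concat (replicate m w))  ≤⟨ maps-power-≤ w m v ⟩
  ΣMℓ w ^ m                        ≡⟨ *-identityˡ (ΣMℓ w ^ m) ⟨
  1 * ΣMℓ w ^ m                    ≤⟨ *-monoˡ-≤ (ΣMℓ w ^ m) (nCk>0 (m≤n+m n m)) ⟩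
  ((m + n) C n) * ΣMℓ w ^ m        ∎
  where open ≤-Reasoning
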